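{- There is no Turing machine that, upon input of the code of an arbitrary computable binary-valued function class $\mathcal{G}\subseteq\{0,1\}^{\mathbb{N}}$, decides whether $\operatorname{VCdim}(\mathcal{G})<\infty$. That is, finiteness of the VC-dimension is Turing undecidable.
   Context: $\mathbb{N}=\{0,1,2,\dots\}$. A class $\mathcal{G}\subseteq\mathbb{N}^{\mathbb{N}}$ is computable if there is a total computable function $G:\mathbb{N}\times\mathbb{N}\to\mathbb{N}$ with $\mathcal{G}=\{n\mapsto G(m,n): m\in\mathbb{N}\}$; it is binary-valued if all its functions take values in $\{0,1\}$. Fix a universal Turing machine; the code of a computable class is the code (index with respect to this universal machine) of such a function $G$. The VC-dimension of $\mathcal{G}\subseteq\{0,1\}^{\mathcal{X}}$ is $\operatorname{VCdim}(\mathcal{G})=\sup\{n\in\mathbb{N}: \exists S\subseteq\mathcal{X}, |S|=n, |\mathcal{G}|_S|=2^n\}$. The decider is only required to work on inputs that are codes of total computable functions $G$ describing binary-valued classes. -}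

module Defs where

open import Data.Nat using (ℕ; zero; suc; _+_; _≤_; _<_)
open import Data.Nat.DivMod using (_/_; _%_)
open import Data.Product using (Σ; ∃; ∃-syntax; _×_; _,_; proj₁; proj₂)
open import Data.Fin using (Fin; toℕ)
open import Function.Definitions using (Injective)
open import Relation.Binary.PropositionalEquality using (_≡_)
open import Relation.Nullary using (¬_)

-- Cantor pairing on ℕ (bijection ℕ × ℕ ≅ ℕ, enumerating diagonals)

tri : ℕ → ℕ
tri zero    = zero
tri (suc d) = suc d + tri d

pair : ℕ → ℕ → ℕ
pair a b = tri (a + b) + b

unpair : ℕ → ℕ × ℕ
unpair zero = 0 , 0
unpair (suc n) with unpair n
... | zero  , b = suc b , 0
... | suc a , b = a , suc b

-- A Turing-complete model of computation: unary μ-recursive programs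
-- on ℕ (multiple arguments / results via the Cantor pairing).

data Code : Set where
  zer  : Code
  sucC : Code
  idC  : Code
  fstC : Code
  sndC : Code
  comp : Code → Code → Code
  pairC : Code → Code → Code
  rec  : Code → Code → Code
  mu   : Code → Code

infix 4 _⊢_⇓_
data _⊢_⇓_ : Code → ℕ → ℕ → Set where
  zer⇓   : ∀ {x} → zer ⊢ x ⇓ 0
  suc⇓   : ∀ {x} → sucC ⊢ x ⇓ suc x
  id⇓    : ∀ {x} → idC ⊢ x ⇓ x
  fst⇓   : ∀ {x} → fstC ⊢ x ⇓ proj₁ (unpair x)
  snd⇓   : ∀ {x} → sndC ⊢ x ⇓ proj₂ (unpair x)
  comp⇓  : ∀ {f g x y z} → g ⊢ x ⇓ y → f ⊢ y ⇓ z → comp f g ⊢ x ⇓ z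
  pair⇓  : ∀ {f g x a b} → f ⊢ x ⇓ a → g ⊢ x ⇓ b → pairC f g ⊢ x ⇓ pair a b
  rec0⇓  : ∀ {f g x y} → f ⊢ x ⇓ y → rec f g ⊢ pair x 0 ⇓ y
  recS⇓  : ∀ {f g x n r z} → rec f g ⊢ pair x n ⇓ r → g ⊢ pair (pair x n) r ⇓ z →
           rec f g ⊢ pair x (suc n) ⇓ z
  mu⇓    : ∀ {f x n} → f ⊢ pair x n ⇓ 0 →
           (∀ m → m < n → ∃[ k ] (f ⊢ pair x m ⇓ suc k)) → mu f ⊢ x ⇓ n

build : ℕ → Code → Code → Code → Code
build 0 _ _ _ = zer
build 1 _ _ _ = sucC
build 2 _ _ _ = idC
build 3 _ _ _ = fstC
build 4 _ _ _ = sndC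
build 5 p q _ = comp p q
build 6 p q _ = pairC p q
build 7 p q _ = rec p q
build _ _ _ r = mu r

decodeF : ℕ → ℕ → Code
decodeF zero    _       = zer
decodeF (suc k) zero    = zer
decodeF (suc k) (suc m) =
  build (m % 9) (decodeF k (proj₁ (unpair (m / 9))))
                (decodeF k (proj₂ (unpair (m / 9))))
                (decodeF k (m / 9))

decode : ℕ → Code
decode e = decodeF e e

-- Code e is the code of a total computable G : ℕ × ℕ → ℕ (G(m,n) = φ_e⟨m,n⟩)
-- taking values in {0,1}; the class is {n ↦ G(m,n) : m ∈ ℕ}.
TotalBinaryClass : ℕ → Set
TotalBinaryClass e = ∀ m n → ∃[ y ] ((decode e ⊢ pair m n ⇓ y) × y ≤ 1)

Shatters : ℕ → ∀ {k} → (Fin k → ℕ) → Set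
Shatters e {k} S = (b : Fin k → Fin 2) → ∃[ m ] (∀ i → decode e ⊢ pair m (S i) ⇓ toℕ (b i))

FiniteVCdim : ℕ → Set
FiniteVCdim e = ∃[ d ] (∀ k (S : Fin k → ℕ) → Injective _≡_ _≡_ S → Shatters e S → k ≤ d)

DecidesOnClasses : Code → (ℕ → Set) → Set
DecidesOnClasses d P = ∀ e → TotalBinaryClass e →
  ∃[ y ] ((d ⊢ e ⇓ y) × (P e → y ≡ 1) × (¬ P e → y ≡ 0))

module Submission where

-- By Kleene's recursion theorem there is a computable class that knows its own
-- code e. Given a purported decider D, let its member ⟨w , s⟩ be the bit list s
-- if D, with μ-searches bounded by w, outputs 1 ("finite") on e, and the zero
-- function otherwise. If D outputs 1 on e, every finite bit pattern occurs in
-- the class, so all initial segments of ℕ are shattered; otherwise the class is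
-- {0}, of VC-dimension 0. Either way D is wrong on e. The bounded run of D is a
-- computable function of (w , e), by a clocked evaluator of μ-recursive programs.

open import Data.Fin using (Fin; toℕ; #_) renaming (zero to fzero; suc to fsuc)
open import Data.Fin.Properties using (toℕ<n; toℕ-injective)
open import Data.Nat
open import Data.Nat.DivMod
  using (_/_; _%_; [m+kn]%n≡m%n; m<n⇒m%n≡m; +-distrib-/-∣ʳ; m<n⇒m/n≡0; m*n/n≡m; m/n≤m)
open import Data.Nat.Divisibility using (divides-refl)
open import Data.Nat.GeneralisedArithmetic using (fold; iterate; iterate-is-fold)
open import Data.Nat.Properties
open import Data.Product using (Σ; ∃-syntax; _×_; _,_; proj₁; proj₂)
open import Data.Sum using (inj₁; inj₂)
open import Function.Definitions using (Injective)
open import Relation.Binary.PropositionalEquality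
open import Relation.Nullary using (¬_; yes; no; contradiction)

open import Defs

π₁ π₂ : ℕ → ℕ
π₁ z = proj₁ (unpair z)
π₂ z = proj₂ (unpair z)

pair-suc-zero : ∀ b → pair (suc b) 0 ≡ suc (pair 0 b)
pair-suc-zero b rewrite +-identityʳ b | +-identityʳ (suc b + tri b) = cong suc (+-comm b (tri b))

pair-x-suc : ∀ a b → pair a (suc b) ≡ suc (pair (suc a) b)
pair-x-suc a b rewrite +-suc a b = +-suc (tri (suc (a + b))) b

pair-unpair : ∀ z → pair (π₁ z) (π₂ z) ≡ z
pair-unpair zero = refl
pair-unpair (suc z) with unpair z | pair-unpair z
... | zero  , b | eq = trans (pair-suc-zero b) (cong suc eq)
... | suc a , b | eq = trans (pair-x-suc a b) (cong suc eq)

unpair-suc-zero : ∀ n {b} → unpair n ≡ (0 , b) → unpair (suc n) ≡ (suc b , 0)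
unpair-suc-zero _ eq rewrite eq = refl

unpair-suc-suc : ∀ n {a b} → unpair n ≡ (suc a , b) → unpair (suc n) ≡ (a , suc b)
unpair-suc-suc _ eq rewrite eq = refl

-- Induction on the diagonal index s = a + b, and along the diagonal on b.
unpair-pair-on-diagonal : ∀ s a b → a + b ≡ s → unpair (pair a b) ≡ (a , b)
unpair-pair-on-diagonal s a (suc b) a+1+b≡s =
  trans (cong unpair (pair-x-suc a b))
        (unpair-suc-suc (pair (suc a) b)
          (unpair-pair-on-diagonal s (suc a) b (trans (sym (+-suc a b)) a+1+b≡s)))
unpair-pair-on-diagonal zero    zero    zero _ = refl
unpair-pair-on-diagonal (suc s) (suc a) zero a+0≡s =
  trans (cong unpair (pair-suc-zero a))
        (unpair-suc-zero (pair 0 a)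
          (unpair-pair-on-diagonal s zero a (trans (sym (+-identityʳ a)) (suc-injective a+0≡s))))

unpair-pair : ∀ a b → unpair (pair a b) ≡ (a , b)
unpair-pair a b = unpair-pair-on-diagonal (a + b) a b refl

π₁-pair : ∀ a b → π₁ (pair a b) ≡ a
π₁-pair a b = cong proj₁ (unpair-pair a b)

π₂-pair : ∀ a b → π₂ (pair a b) ≡ b
π₂-pair a b = cong proj₂ (unpair-pair a b)

π-pair : ∀ {A : Set} (E : ℕ → ℕ → A) a b → E (π₁ (pair a b)) (π₂ (pair a b)) ≡ E a b
π-pair E a b = cong₂ E (π₁-pair a b) (π₂-pair a b)

π₁-≤ : ∀ z → π₁ z ≤ z
π₁-≤ z = subst (π₁ z ≤_) (pair-unpair z)
  (≤-trans (≤-trans (m≤m+n (π₁ z) (π₂ z)) (n≤tri _)) (m≤m+n _ (π₂ z)))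
  where
  n≤tri : ∀ n → n ≤ tri n
  n≤tri zero    = z≤n
  n≤tri (suc n) = s≤s (m≤m+n n (tri n))

π₂-≤ : ∀ z → π₂ z ≤ z
π₂-≤ z = subst (π₂ z ≤_) (pair-unpair z) (m≤n+m (π₂ z) _)

Computable : (ℕ → ℕ) → Set
Computable F = Σ Code λ c → ∀ x → c ⊢ x ⇓ F x

Computable₂ : (ℕ → ℕ → ℕ) → Set
Computable₂ E = Computable (λ z → E (π₁ z) (π₂ z))

Computable₃ : (ℕ → ℕ → ℕ → ℕ) → Set
Computable₃ H = Computable (λ w → H (π₁ (π₁ w)) (π₂ (π₁ w)) (π₂ w))

computable-cong : ∀ {F G} → (∀ x → F x ≡ G x) → Computable F → Computable G
computable-cong F≗G (c , c⇓) = c , λ x → subst (c ⊢ x ⇓_) (F≗G x) (c⇓ x)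

zeroᶜ : Computable (λ _ → 0)
zeroᶜ = zer , λ _ → zer⇓

sucᶜ : Computable suc
sucᶜ = sucC , λ _ → suc⇓

idᶜ : Computable (λ x → x)
idᶜ = idC , λ _ → id⇓

π₁ᶜ : Computable π₁
π₁ᶜ = fstC , λ _ → fst⇓

π₂ᶜ : Computable π₂
π₂ᶜ = sndC , λ _ → snd⇓

infixr 9 _∘ᶜ_

_∘ᶜ_ : ∀ {F G} → Computable F → Computable G → Computable (λ x → F (G x))
(f , f⇓) ∘ᶜ (g , g⇓) = comp f g , λ x → comp⇓ (g⇓ x) (f⇓ _)

⟨_,_⟩ᶜ : ∀ {F G} → Computable F → Computable G → Computable (λ x → pair (F x) (G x))
⟨ (f , f⇓) , (g , g⇓) ⟩ᶜ = pairC f g , λ x → pair⇓ (f⇓ x) (g⇓ x)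

apply₂ᶜ : ∀ {E A B} → Computable₂ E → Computable A → Computable B → Computable (λ x → E (A x) (B x))
apply₂ᶜ {E} {A} {B} e a b = computable-cong (λ x → π-pair E (A x) (B x)) (e ∘ᶜ ⟨ a , b ⟩ᶜ)

constᶜ : ∀ n → Computable (λ _ → n)
constᶜ zero    = zeroᶜ
constᶜ (suc n) = sucᶜ ∘ᶜ constᶜ n

_+ᶜ_ : ∀ n {A} → Computable A → Computable (λ x → n + A x)
zero  +ᶜ a = a
suc n +ᶜ a = sucᶜ ∘ᶜ (n +ᶜ a)

primRec : (ℕ → ℕ) → (ℕ → ℕ → ℕ → ℕ) → ℕ → ℕ → ℕ
primRec f h x zero    = f x
primRec f h x (suc n) = h x n (primRec f h x n)

primRec-cong : ∀ {f f′ h h′ x x′} → f x ≡ f′ x′ → (∀ n r → h x n r ≡ h′ x′ n r) →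
               ∀ n → primRec f h x n ≡ primRec f′ h′ x′ n
primRec-cong           f≡ h≡ zero    = f≡
primRec-cong {h′ = h′} f≡ h≡ (suc n) = trans (h≡ n _) (cong (h′ _ n) (primRec-cong f≡ h≡ n))

primRecᶜ : ∀ {f h A N} → Computable f → Computable₃ h → Computable A → Computable N →
           Computable (λ x → primRec f h (A x) (N x))
primRecᶜ {f} {h} {A} {N} (cf , f⇓) (ch , h⇓) (ca , a⇓) (cn , n⇓) =
  comp (rec cf ch) (pairC ca cn) , λ x → comp⇓ (pair⇓ (a⇓ x) (n⇓ x)) (rec⇓ (A x) (N x))
  where
  step⇓ : ∀ x n r → ch ⊢ pair (pair x n) r ⇓ h x n r
  step⇓ x n r = subst (ch ⊢ pair (pair x n) r ⇓_)
    (trans (π-pair (λ p r → h (π₁ p) (π₂ p) r) (pair x n) r) (π-pair (λ x n → h x n r) x n))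
    (h⇓ (pair (pair x n) r))

  rec⇓ : ∀ x n → rec cf ch ⊢ pair x n ⇓ primRec f h x n
  rec⇓ x zero    = rec0⇓ {x = x} (f⇓ x)
  rec⇓ x (suc n) = recS⇓ {x = x} {n = n} (rec⇓ x n) (step⇓ x n _)

ifz : ℕ → ℕ → ℕ → ℕ
ifz zero    a b = a
ifz (suc _) a b = b

ifzᶜ : ∀ {C A B} → Computable C → Computable A → Computable B → Computable (λ x → ifz (C x) (A x) (B x))
ifzᶜ {C} {A} {B} c a b =
  computable-cong (λ x → primRec-ifz (A x) (B x) (C x)) (primRecᶜ π₁ᶜ (π₂ᶜ ∘ᶜ π₁ᶜ ∘ᶜ π₁ᶜ) ⟨ a , b ⟩ᶜ c)
  where
  primRec-ifz : ∀ a b n → primRec π₁ (λ p _ _ → π₂ p) (pair a b) n ≡ ifz n a b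
  primRec-ifz a b zero    = π₁-pair a b
  primRec-ifz a b (suc n) = π₂-pair a b

predᶜ : ∀ {A} → Computable A → Computable (λ x → pred (A x))
predᶜ {A} a = computable-cong (λ x → primRec-pred (A x)) (primRecᶜ zeroᶜ (π₂ᶜ ∘ᶜ π₁ᶜ) zeroᶜ a)
  where
  primRec-pred : ∀ n → primRec (λ _ → 0) (λ _ m _ → m) 0 n ≡ pred n
  primRec-pred zero    = refl
  primRec-pred (suc n) = refl

timesᶜ : ∀ c {A} → Computable A → Computable (λ x → A x * c)
timesᶜ c {A} a = computable-cong (λ x → primRec-* (A x)) (primRecᶜ zeroᶜ (c +ᶜ π₂ᶜ) zeroᶜ a)
  where
  primRec-* : ∀ n → primRec (λ _ → 0) (λ _ _ r → c + r) 0 n ≡ n * c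
  primRec-* zero    = refl
  primRec-* (suc n) = cong (c +_) (primRec-* n)

-- Results are shifted: eval c k x is suc y when the run of c on x halts with
-- output y and every μ-search in it succeeds below k, and 0 otherwise.
-- A μ-search is in state 0 (running), 1 (some probe failed) or suc (suc n) (found n).
searchStep : (ℕ → ℕ) → ℕ → ℕ → ℕ
searchStep φ j s = ifz s (ifz (φ j) 1 (ifz (pred (φ j)) (suc (suc j)) 0)) s

search : (ℕ → ℕ) → ℕ → ℕ
search φ = primRec (λ _ → 0) (λ _ → searchStep φ) 0

recStep : (ℕ → ℕ) → ℕ → ℕ → ℕ → ℕ
recStep ψ a n r = ifz r 0 (ψ (pair (pair a n) (pred r)))

eval : Code → ℕ → ℕ → ℕ
eval zer         k x = 1
eval sucC        k x = suc (suc x)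
eval idC         k x = suc x
eval fstC        k x = suc (π₁ x)
eval sndC        k x = suc (π₂ x)
eval (comp f g)  k x = ifz (eval g k x) 0 (eval f k (pred (eval g k x)))
eval (pairC f g) k x =
  ifz (eval f k x) 0 (ifz (eval g k x) 0 (suc (pair (pred (eval f k x)) (pred (eval g k x)))))
eval (rec f g)   k x = primRec (eval f k) (recStep (eval g k)) (π₁ x) (π₂ x)
eval (mu f)      k x = pred (search (λ m → eval f k (pair x m)) k)

eval-computable : ∀ c → Computable₂ (eval c)
eval-computable zer         = constᶜ 1
eval-computable sucC        = sucᶜ ∘ᶜ sucᶜ ∘ᶜ π₂ᶜ
eval-computable idC         = sucᶜ ∘ᶜ π₂ᶜ
eval-computable fstC        = sucᶜ ∘ᶜ π₁ᶜ ∘ᶜ π₂ᶜ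
eval-computable sndC        = sucᶜ ∘ᶜ π₂ᶜ ∘ᶜ π₂ᶜ
eval-computable (comp f g)  = ifzᶜ G zeroᶜ (apply₂ᶜ {eval f} (eval-computable f) π₁ᶜ (predᶜ G))
  where
  G : Computable₂ (eval g)
  G = eval-computable g
eval-computable (pairC f g) = ifzᶜ F zeroᶜ (ifzᶜ G zeroᶜ (sucᶜ ∘ᶜ ⟨ predᶜ F , predᶜ G ⟩ᶜ))
  where
  F : Computable₂ (eval f)
  F = eval-computable f

  G : Computable₂ (eval g)
  G = eval-computable g
eval-computable (rec f g)   =
  computable-cong (λ z → primRec-cong (π-pair (eval f) (π₁ z) (π₁ (π₂ z)))
                                      (λ n r → π-pair (λ k a → recStep (eval g k) a n r) (π₁ z) (π₁ (π₂ z)))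
                                      (π₂ (π₂ z)))
    (primRecᶜ {h = λ p → recStep (eval g (π₁ p)) (π₂ p)}
              (eval-computable f) step ⟨ π₁ᶜ , π₁ᶜ ∘ᶜ π₂ᶜ ⟩ᶜ (π₂ᶜ ∘ᶜ π₂ᶜ))
  where
  step : Computable₃ (λ p → recStep (eval g (π₁ p)) (π₂ p))
  step = ifzᶜ π₂ᶜ zeroᶜ (apply₂ᶜ {eval g} (eval-computable g) (π₁ᶜ ∘ᶜ π₁ᶜ ∘ᶜ π₁ᶜ)
                           ⟨ ⟨ π₂ᶜ ∘ᶜ π₁ᶜ ∘ᶜ π₁ᶜ , π₂ᶜ ∘ᶜ π₁ᶜ ⟩ᶜ , predᶜ π₂ᶜ ⟩ᶜ)
eval-computable (mu f)      =
  predᶜ (computable-cong (λ z → primRec-cong refl (λ _ _ → refl) (π₁ z)) (primRecᶜ zeroᶜ step idᶜ π₁ᶜ))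
  where
  probe : Computable (λ w → eval f (π₁ (π₁ (π₁ w))) (pair (π₂ (π₁ (π₁ w))) (π₂ (π₁ w))))
  probe = apply₂ᶜ {eval f} (eval-computable f) (π₁ᶜ ∘ᶜ π₁ᶜ ∘ᶜ π₁ᶜ) ⟨ π₂ᶜ ∘ᶜ π₁ᶜ ∘ᶜ π₁ᶜ , π₂ᶜ ∘ᶜ π₁ᶜ ⟩ᶜ

  step : Computable₃ (λ p → searchStep (λ m → eval f (π₁ p) (pair (π₂ p) m)))
  step = ifzᶜ π₂ᶜ (ifzᶜ probe (constᶜ 1) (ifzᶜ (predᶜ probe) (2 +ᶜ π₂ᶜ ∘ᶜ π₁ᶜ) zeroᶜ)) π₂ᶜ

NonzeroBelow : (ℕ → ℕ) → ℕ → Set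
NonzeroBelow φ n = ∀ m → m < n → ∃[ t ] (φ m ≡ suc (suc t))

NonzeroBelow-suc : ∀ {φ n t} → NonzeroBelow φ n → φ n ≡ suc (suc t) → NonzeroBelow φ (suc n)
NonzeroBelow-suc {t = t} below φn m m<1+n with m<1+n⇒m<n∨m≡n m<1+n
... | inj₁ m<n  = below m m<n
... | inj₂ refl = t , φn

search-running : ∀ φ j → search φ j ≡ 0 → NonzeroBelow φ j
search-running φ zero    _  m ()
search-running φ (suc j) eq with search φ j in sj | φ j in φj
search-running φ (suc j) () | zero  | zero
search-running φ (suc j) () | zero  | suc zero
search-running φ (suc j) _  | zero  | suc (suc t) = NonzeroBelow-suc (search-running φ j sj) φj
search-running φ (suc j) () | suc _ | _

search-found : ∀ φ j {n} → search φ j ≡ suc (suc n) → φ n ≡ 1 × NonzeroBelow φ n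
search-found φ (suc j) eq with search φ j in sj | φ j in φj
search-found φ (suc j) ()   | zero  | zero
search-found φ (suc j) refl | zero  | suc zero    = φj , search-running φ j sj
search-found φ (suc j) ()   | zero  | suc (suc t)
search-found φ (suc j) eq   | suc _ | _           = search-found φ j (trans sj eq)

search-zero : ∀ φ n → NonzeroBelow φ n → search φ n ≡ 0
search-zero φ zero    _     = refl
search-zero φ (suc n) below
  rewrite search-zero φ n (λ m m<n → below m (m<n⇒m<1+n m<n))
        | proj₂ (below n ≤-refl) = refl

search-finds : ∀ φ n → NonzeroBelow φ n → φ n ≡ 1 → search φ (suc n) ≡ suc (suc n)
search-finds φ n below φn rewrite search-zero φ n below | φn = refl

search-stable : ∀ φ {j k s} → j ≤′ k → search φ j ≡ suc s → search φ k ≡ suc s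
search-stable φ ≤′-refl       eq = eq
search-stable φ (≤′-step j≤k) eq rewrite search-stable φ j≤k eq = refl

pred≡1+⇒≡2+ : ∀ {s y} → pred s ≡ suc y → s ≡ suc (suc y)
pred≡1+⇒≡2+ {suc s} eq = cong suc eq

eval-sound : ∀ c {k x y} → eval c k x ≡ suc y → c ⊢ x ⇓ y
eval-sound zer  refl = zer⇓
eval-sound sucC refl = suc⇓
eval-sound idC  refl = id⇓
eval-sound fstC refl = fst⇓
eval-sound sndC refl = snd⇓
eval-sound (comp f g) {k} {x} eq with eval g k x in eg
... | suc y′ = comp⇓ (eval-sound g eg) (eval-sound f eq)
eval-sound (pairC f g) {k} {x} eq with eval f k x in ef | eval g k x in eg
eval-sound (pairC f g) refl | suc a | suc b = pair⇓ (eval-sound f ef) (eval-sound g eg)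
eval-sound (rec f g) {k} {x} eq =
  subst (λ z → rec f g ⊢ z ⇓ _) (pair-unpair x) (rec-sound (π₁ x) (π₂ x) eq)
  where
  rec-sound : ∀ a n {y} → primRec (eval f k) (recStep (eval g k)) a n ≡ suc y → rec f g ⊢ pair a n ⇓ y
  rec-sound a zero    eq = rec0⇓ {x = a} (eval-sound f eq)
  rec-sound a (suc n) eq with primRec (eval f k) (recStep (eval g k)) a n in er
  ... | suc r = recS⇓ {x = a} {n = n} (rec-sound a n er) (eval-sound g eq)
eval-sound (mu f) {k} {x} eq with search-found (λ m → eval f k (pair x m)) k (pred≡1+⇒≡2+ eq)
... | φy≡1 , below = mu⇓ (eval-sound f φy≡1) λ m m<y → let t , φm = below m m<y in t , eval-sound f φm

Eventually : (ℕ → Set) → Set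
Eventually P = ∃[ K ] (∀ k → K ≤ k → P k)

eventually-map : ∀ {P Q : ℕ → Set} → (∀ {k} → P k → Q k) → Eventually P → Eventually Q
eventually-map P⇒Q (K , p) = K , λ k K≤k → P⇒Q (p k K≤k)

eventually-× : ∀ {P Q : ℕ → Set} → Eventually P → Eventually Q → Eventually (λ k → P k × Q k)
eventually-× (K , p) (L , q) = K ⊔ L , λ k K⊔L≤k → p k (m⊔n≤o⇒m≤o K L K⊔L≤k) , q k (m⊔n≤o⇒n≤o K L K⊔L≤k)

eventually-≥ : ∀ n → Eventually (n ≤_)
eventually-≥ n = n , λ _ n≤k → n≤k

eventually-∀< : ∀ {P : ℕ → ℕ → Set} n → (∀ m → m < n → Eventually (P m)) →
                Eventually (λ k → ∀ m → m < n → P m k)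
eventually-∀<     zero    _  = 0 , λ _ _ _ ()
eventually-∀< {P} (suc n) ev =
  eventually-map extend
    (eventually-× (eventually-∀< n (λ m m<n → ev m (m<n⇒m<1+n m<n))) (ev n ≤-refl))
  where
  extend : ∀ {k} → (∀ m → m < n → P m k) × P n k → ∀ m → m < suc n → P m k
  extend (below , at-n) m m<1+n with m<1+n⇒m<n∨m≡n m<1+n
  ... | inj₁ m<n  = below m m<n
  ... | inj₂ refl = at-n

eval-complete : ∀ {c x y} → c ⊢ x ⇓ y → Eventually (λ k → eval c k x ≡ suc y)
eval-complete zer⇓ = 0 , λ _ _ → refl
eval-complete suc⇓ = 0 , λ _ _ → refl
eval-complete id⇓  = 0 , λ _ _ → refl
eval-complete fst⇓ = 0 , λ _ _ → refl
eval-complete snd⇓ = 0 , λ _ _ → refl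
eval-complete {comp f g} (comp⇓ g⇓ f⇓) =
  eventually-map (λ {k} (eg , ef) → trans (cong (λ r → ifz r 0 (eval f k (pred r))) eg) ef)
    (eventually-× (eval-complete g⇓) (eval-complete f⇓))
eval-complete (pair⇓ f⇓ g⇓) =
  eventually-map (λ (ef , eg) → cong₂ (λ a b → ifz a 0 (ifz b 0 (suc (pair (pred a) (pred b))))) ef eg)
    (eventually-× (eval-complete f⇓) (eval-complete g⇓))
eval-complete {rec f g} (rec0⇓ {x = x} f⇓) =
  eventually-map (λ {k} → trans (π-pair (primRec (eval f k) (recStep (eval g k))) x 0))
    (eval-complete f⇓)
eval-complete {rec f g} (recS⇓ {x = x} {n = n} {r = r} {z = z} r⇓ g⇓) =
  eventually-map (λ {k} (er , eg) → begin
      eval (rec f g) k (pair x (suc n))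
    ≡⟨ π-pair (primRec (eval f k) (recStep (eval g k))) x (suc n) ⟩
      recStep (eval g k) x n (primRec (eval f k) (recStep (eval g k)) x n)
    ≡⟨ cong (recStep (eval g k) x n) (trans (sym (π-pair (primRec (eval f k) (recStep (eval g k))) x n)) er) ⟩
      eval g k (pair (pair x n) r)
    ≡⟨ eg ⟩
      suc z
    ∎)
    (eventually-× (eval-complete r⇓) (eval-complete g⇓))
  where open ≡-Reasoning
eval-complete {mu f} {x} (mu⇓ {n = n} f⇓0 below) =
  eventually-map (λ {k} ((n<k , at-n) , before-n) →
      cong pred (search-stable (φ k) (≤⇒≤′ n<k) (search-finds (φ k) n before-n at-n)))
    (eventually-× (eventually-× (eventually-≥ (suc n)) (eval-complete f⇓0))
                  (eventually-∀< n λ m m<n →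
                     let t , f⇓ = below m m<n in eventually-map (t ,_) (eval-complete f⇓)))
  where
  φ : ℕ → ℕ → ℕ
  φ k m = eval f k (pair x m)

⇓-deterministic : ∀ {c x y y′} → c ⊢ x ⇓ y → c ⊢ x ⇓ y′ → y ≡ y′
⇓-deterministic c⇓y c⇓y′ with eventually-× (eval-complete c⇓y) (eval-complete c⇓y′)
... | K , both = let e , e′ = both K ≤-refl in suc-injective (trans (sym e) e′)

build-cong : ∀ {t t′ p p′ q q′ r r′} → t ≡ t′ → p ≡ p′ → q ≡ q′ → r ≡ r′ → build t p q r ≡ build t′ p′ q′ r′
build-cong refl refl refl refl = refl

decodeF-stable : ∀ {k k′} c → c ≤ k → c ≤ k′ → decodeF k c ≡ decodeF k′ c
decodeF-stable {zero}  {zero}   zero    _ _ = refl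
decodeF-stable {zero}  {suc _}  zero    _ _ = refl
decodeF-stable {suc _} {zero}   zero    _ _ = refl
decodeF-stable {suc _} {suc _}  zero    _ _ = refl
decodeF-stable {suc k} {suc k′} (suc m) (s≤s m≤k) (s≤s m≤k′) =
  build-cong refl
    (decodeF-stable _ (≤-trans (π₁-≤ _) q≤k) (≤-trans (π₁-≤ _) q≤k′))
    (decodeF-stable _ (≤-trans (π₂-≤ _) q≤k) (≤-trans (π₂-≤ _) q≤k′))
    (decodeF-stable _ q≤k q≤k′)
  where
  q≤k : m / 9 ≤ k
  q≤k = ≤-trans (m/n≤m m 9) m≤k

  q≤k′ : m / 9 ≤ k′
  q≤k′ = ≤-trans (m/n≤m m 9) m≤k′

tagged : Fin 9 → ℕ → ℕ
tagged t q = suc (toℕ t + q * 9)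

decode-tagged : ∀ t q → decode (tagged t q) ≡ build (toℕ t) (decode (π₁ q)) (decode (π₂ q)) (decode q)
decode-tagged t q =
  build-cong tag
    (trans (cong (λ q′ → decodeF m (π₁ q′)) quotient) (decodeF-stable _ (≤-trans (π₁-≤ q) q≤m) ≤-refl))
    (trans (cong (λ q′ → decodeF m (π₂ q′)) quotient) (decodeF-stable _ (≤-trans (π₂-≤ q) q≤m) ≤-refl))
    (trans (cong (decodeF m) quotient) (decodeF-stable q q≤m ≤-refl))
  where
  m : ℕ
  m = toℕ t + q * 9

  tag : m % 9 ≡ toℕ t
  tag = trans ([m+kn]%n≡m%n (toℕ t) q 9) (m<n⇒m%n≡m (toℕ<n t))

  quotient : m / 9 ≡ q
  quotient = begin
    (toℕ t + q * 9) / 9     ≡⟨ +-distrib-/-∣ʳ (toℕ t) (divides-refl q) ⟩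
    toℕ t / 9 + q * 9 / 9   ≡⟨ cong₂ _+_ (m<n⇒m/n≡0 (toℕ<n t)) (m*n/n≡m q 9) ⟩
    q                       ∎
    where open ≡-Reasoning

  q≤m : q ≤ m
  q≤m = ≤-trans (m≤m*n q 9) (m≤n+m (q * 9) (toℕ t))

decode-binary : ∀ t p q →
                decode (tagged t (pair p q)) ≡ build (toℕ t) (decode p) (decode q) (decode (pair p q))
decode-binary t p q =
  trans (decode-tagged t (pair p q))
        (build-cong refl (cong decode (π₁-pair p q)) (cong decode (π₂-pair p q)) refl)

compCode pairCode : ℕ → ℕ → ℕ
compCode p q = tagged (# 5) (pair p q)
pairCode p q = tagged (# 6) (pair p q)

encode : Code → ℕ
encode zer         = 0
encode sucC        = tagged (# 1) 0
encode idC         = tagged (# 2) 0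
encode fstC        = tagged (# 3) 0
encode sndC        = tagged (# 4) 0
encode (comp p q)  = compCode (encode p) (encode q)
encode (pairC p q) = pairCode (encode p) (encode q)
encode (rec p q)   = tagged (# 7) (pair (encode p) (encode q))
encode (mu r)      = tagged (# 8) (encode r)

decode-encode : ∀ c → decode (encode c) ≡ c
decode-encode zer         = refl
decode-encode sucC        = refl
decode-encode idC         = refl
decode-encode fstC        = refl
decode-encode sndC        = refl
decode-encode (comp p q)  =
  trans (decode-binary (# 5) (encode p) (encode q)) (cong₂ comp (decode-encode p) (decode-encode q))
decode-encode (pairC p q) =
  trans (decode-binary (# 6) (encode p) (encode q)) (cong₂ pairC (decode-encode p) (decode-encode q))
decode-encode (rec p q)   =
  trans (decode-binary (# 7) (encode p) (encode q)) (cong₂ rec (decode-encode p) (decode-encode q))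
decode-encode (mu r)      = trans (decode-tagged (# 8) (encode r)) (cong mu (decode-encode r))

taggedᶜ : ∀ t {Q} → Computable Q → Computable (λ x → tagged t (Q x))
taggedᶜ t q = sucᶜ ∘ᶜ (toℕ t +ᶜ timesᶜ 9 q)

compCodeᶜ : ∀ {A B} → Computable A → Computable B → Computable (λ x → compCode (A x) (B x))
compCodeᶜ a b = taggedᶜ (# 5) ⟨ a , b ⟩ᶜ

pairCodeᶜ : ∀ {A B} → Computable A → Computable B → Computable (λ x → pairCode (A x) (B x))
pairCodeᶜ a b = taggedᶜ (# 6) ⟨ a , b ⟩ᶜ

constCode : ℕ → ℕ
constCode zero    = encode zer
constCode (suc a) = compCode (encode sucC) (constCode a)

constCode⇓ : ∀ a {x} → decode (constCode a) ⊢ x ⇓ a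
constCode⇓ zero    = zer⇓
constCode⇓ (suc a) =
  subst (_⊢ _ ⇓ suc a) (sym (decode-binary (# 5) (encode sucC) (constCode a))) (comp⇓ (constCode⇓ a) suc⇓)

constCodeᶜ : Computable constCode
constCodeᶜ =
  computable-cong primRec-constCode (primRecᶜ zeroᶜ (compCodeᶜ (constᶜ (encode sucC)) π₂ᶜ) zeroᶜ idᶜ)
  where
  primRec-constCode : ∀ n → primRec (λ _ → 0) (λ _ _ → compCode (encode sucC)) 0 n ≡ constCode n
  primRec-constCode zero    = refl
  primRec-constCode (suc n) = cong (compCode (encode sucC)) (primRec-constCode n)

-- Opaque, like selfCode below: otherwise unification normalises codes to huge numerals.
opaque
  diagonalCode : ℕ → ℕ → ℕ
  diagonalCode f a = compCode f (pairCode (compCode a (constCode a)) (encode idC))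

  diagonalCodeᶜ : ∀ f → Computable (diagonalCode f)
  diagonalCodeᶜ f = compCodeᶜ (constᶜ f) (pairCodeᶜ (compCodeᶜ idᶜ constCodeᶜ) (constᶜ (encode idC)))

  decode-diagonalCode : ∀ f a →
    decode (diagonalCode f a) ≡ comp (decode f) (pairC (comp (decode a) (decode (constCode a))) idC)
  decode-diagonalCode f a = begin
      decode (diagonalCode f a)
    ≡⟨ decode-binary (# 5) f _ ⟩
      comp (decode f) (decode (pairCode (compCode a (constCode a)) (encode idC)))
    ≡⟨ cong (comp (decode f)) (decode-binary (# 6) (compCode a (constCode a)) (encode idC)) ⟩
      comp (decode f) (pairC (decode (compCode a (constCode a))) idC)
    ≡⟨ cong (λ c → comp (decode f) (pairC c idC)) (decode-binary (# 5) a (constCode a)) ⟩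
      comp (decode f) (pairC (comp (decode a) (decode (constCode a))) idC)
    ∎
    where open ≡-Reasoning

diagonalCode⇓ : ∀ {F : ℕ → ℕ} {f a e} → (∀ w → decode f ⊢ w ⇓ F w) → decode a ⊢ a ⇓ e →
                ∀ z → decode (diagonalCode f a) ⊢ z ⇓ F (pair e z)
diagonalCode⇓ {F} {f} {a} {e} f⇓ a⇓ z =
  subst (_⊢ z ⇓ F (pair e z)) (sym (decode-diagonalCode f a))
    (comp⇓ (pair⇓ (comp⇓ (constCode⇓ a) a⇓) id⇓) (f⇓ (pair e z)))

-- A code a of diagonalCode f itself has φₐ(a) = diagonalCode f a:
-- that code receives its own number as first argument.
recursion-theorem : ∀ {F} → Computable F → ∃[ e ] (∀ z → decode e ⊢ z ⇓ F (pair e z))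
recursion-theorem {F} (f , f⇓) with diagonalCodeᶜ (encode f)
... | d , d⇓ =
  diagonalCode (encode f) (encode d) ,
  diagonalCode⇓ {F} (decoded-runs {F} f f⇓) (decoded-runs {diagonalCode (encode f)} d d⇓ (encode d))
  where
  decoded-runs : ∀ {G} c → (∀ x → c ⊢ x ⇓ G x) → ∀ x → decode (encode c) ⊢ x ⇓ G x
  decoded-runs {G} c c⇓ x = subst (_⊢ x ⇓ G x) (sym (decode-encode c)) (c⇓ x)

shatters-all-prefixes⇒¬FiniteVCdim : ∀ {e} →
  (∀ {k} (b : Fin k → Fin 2) → ∃[ m ] (∀ i → decode e ⊢ pair m (toℕ i) ⇓ toℕ (b i))) →
  ¬ FiniteVCdim e
shatters-all-prefixes⇒¬FiniteVCdim shattered (d , bound) = 1+n≰n (bound (suc d) toℕ toℕ-injective shattered)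

zero-class⇒FiniteVCdim : ∀ {e} → (∀ m n → decode e ⊢ pair m n ⇓ 0) → FiniteVCdim e
zero-class⇒FiniteVCdim {e} zero-class = 0 , bound
  where
  bound : ∀ k (S : Fin k → ℕ) → Injective _≡_ _≡_ S → Shatters e S → k ≤ 0
  bound zero    _ _ _         = z≤n
  bound (suc k) S _ shattered with shattered (λ _ → # 1)
  ... | m , m⇓ = contradiction (⇓-deterministic (m⇓ fzero) (zero-class m (S fzero))) 1+n≢0

-- r = 2 is how eval encodes the output 1.
ifOutputsOne : ℕ → ℕ → ℕ
ifOutputsOne r b = ifz r 0 (ifz (pred r) 0 (ifz (pred (pred r)) b 0))

ifOutputsOneᶜ : ∀ {R B} → Computable R → Computable B → Computable (λ x → ifOutputsOne (R x) (B x))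
ifOutputsOneᶜ r b = ifzᶜ r zeroᶜ (ifzᶜ (predᶜ r) zeroᶜ (ifzᶜ (predᶜ (predᶜ r)) b zeroᶜ))

ifOutputsOne-≤1 : ∀ r {b} → b ≤ 1 → ifOutputsOne r b ≤ 1
ifOutputsOne-≤1 zero                b≤1 = z≤n
ifOutputsOne-≤1 (suc zero)          b≤1 = z≤n
ifOutputsOne-≤1 (suc (suc zero))    b≤1 = b≤1
ifOutputsOne-≤1 (suc (suc (suc r))) b≤1 = z≤n

ifOutputsOne-≢2 : ∀ {r} b → r ≢ 2 → ifOutputsOne r b ≡ 0
ifOutputsOne-≢2 {zero}              b _   = refl
ifOutputsOne-≢2 {suc zero}          b _   = refl
ifOutputsOne-≢2 {suc (suc zero)}    b r≢2 = contradiction refl r≢2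
ifOutputsOne-≢2 {suc (suc (suc r))} b _   = refl

bit : ℕ → ℕ
bit x = ifz x 0 1

bit-≤1 : ∀ x → bit x ≤ 1
bit-≤1 zero    = z≤n
bit-≤1 (suc x) = s≤s z≤n

bit-toℕ : ∀ (b : Fin 2) → bit (toℕ b) ≡ toℕ b
bit-toℕ fzero        = refl
bit-toℕ (fsuc fzero) = refl

bitᶜ : ∀ {A} → Computable A → Computable (λ x → bit (A x))
bitᶜ a = ifzᶜ a zeroᶜ (constᶜ 1)

encodeBits : ∀ {k} → (Fin k → Fin 2) → ℕ
encodeBits {zero}  b = 0
encodeBits {suc k} b = pair (toℕ (b fzero)) (encodeBits (λ i → b (fsuc i)))

nth : ℕ → ℕ → ℕ
nth s n = π₁ (iterate π₂ s n)

nth-encodeBits : ∀ {k} (b : Fin k → Fin 2) i → nth (encodeBits b) (toℕ i) ≡ toℕ (b i)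
nth-encodeBits b fzero    = π₁-pair _ _
nth-encodeBits b (fsuc i) rewrite π₂-pair (toℕ (b fzero)) (encodeBits (λ i → b (fsuc i))) =
  nth-encodeBits (λ i → b (fsuc i)) i

nthᶜ : ∀ {S N} → Computable S → Computable N → Computable (λ x → nth (S x) (N x))
nthᶜ {S} {N} s n =
  π₁ᶜ ∘ᶜ computable-cong (λ x → trans (primRec-fold (S x) (N x)) (iterate-is-fold (S x) π₂ (N x)))
                        (primRecᶜ idᶜ (π₂ᶜ ∘ᶜ π₂ᶜ) s n)
  where
  primRec-fold : ∀ s n → primRec (λ x → x) (λ _ _ → π₂) s n ≡ fold s π₂ n
  primRec-fold s zero    = refl
  primRec-fold s (suc n) = cong π₂ (primRec-fold s n)

module _ (D : Code) where

  member : ℕ → ℕ → ℕ → ℕ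
  member e m n = ifOutputsOne (eval D (π₁ m) e) (bit (nth (π₂ m) n))

  memberᶜ : Computable (λ u → member (π₁ u) (π₁ (π₂ u)) (π₂ (π₂ u)))
  memberᶜ = ifOutputsOneᶜ (apply₂ᶜ {eval D} (eval-computable D) (π₁ᶜ ∘ᶜ π₁ᶜ ∘ᶜ π₂ᶜ) π₁ᶜ)
                          (bitᶜ (nthᶜ (π₂ᶜ ∘ᶜ π₁ᶜ ∘ᶜ π₂ᶜ) (π₂ᶜ ∘ᶜ π₂ᶜ)))

  opaque
    selfCode : ℕ
    selfCode = proj₁ (recursion-theorem memberᶜ)

    selfCode⇓ : ∀ m n → decode selfCode ⊢ pair m n ⇓ member selfCode m n
    selfCode⇓ m n =
      subst (decode selfCode ⊢ pair m n ⇓_)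
        (trans (π-pair (λ e u → member e (π₁ u) (π₂ u)) selfCode (pair m n)) (π-pair (member selfCode) m n))
        (proj₂ (recursion-theorem memberᶜ) (pair m n))

  selfCode-binary : TotalBinaryClass selfCode
  selfCode-binary m n =
    member selfCode m n , selfCode⇓ m n , ifOutputsOne-≤1 (eval D (π₁ m) selfCode) (bit-≤1 (nth (π₂ m) n))

  accepted⇒¬FiniteVCdim : D ⊢ selfCode ⇓ 1 → ¬ FiniteVCdim selfCode
  accepted⇒¬FiniteVCdim D⇓1 with eval-complete D⇓1
  ... | K , accepted-from-K =
    shatters-all-prefixes⇒¬FiniteVCdim {selfCode} λ b →
      pair K (encodeBits b) , λ i →
        subst (decode selfCode ⊢ pair (pair K (encodeBits b)) (toℕ i) ⇓_) (member-bits b i)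
          (selfCode⇓ (pair K (encodeBits b)) (toℕ i))
    where
    member-bits : ∀ {k} (b : Fin k → Fin 2) i → member selfCode (pair K (encodeBits b)) (toℕ i) ≡ toℕ (b i)
    member-bits b i = begin
        member selfCode (pair K (encodeBits b)) (toℕ i)
      ≡⟨ π-pair (λ w s → ifOutputsOne (eval D w selfCode) (bit (nth s (toℕ i)))) K (encodeBits b) ⟩
        ifOutputsOne (eval D K selfCode) (bit (nth (encodeBits b) (toℕ i)))
      ≡⟨ cong₂ ifOutputsOne (accepted-from-K K ≤-refl) (cong bit (nth-encodeBits b i)) ⟩
        bit (toℕ (b i))
      ≡⟨ bit-toℕ (b i) ⟩
        toℕ (b i)
      ∎
      where open ≡-Reasoning

  ¬accepted⇒FiniteVCdim : ¬ (D ⊢ selfCode ⇓ 1) → FiniteVCdim selfCode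
  ¬accepted⇒FiniteVCdim ¬D⇓1 = zero-class⇒FiniteVCdim {selfCode} λ m n →
    subst (decode selfCode ⊢ pair m n ⇓_)
      (ifOutputsOne-≢2 (bit (nth (π₂ m) n)) (λ outputs-1 → ¬D⇓1 (eval-sound D outputs-1)))
      (selfCode⇓ m n)

  no-decider : ¬ DecidesOnClasses D FiniteVCdim
  no-decider decides with decides selfCode selfCode-binary
  ... | y , D⇓y , finite⇒1 , infinite⇒0 with y ≟ 1
  ...   | yes refl = 1+n≢0 (infinite⇒0 (accepted⇒¬FiniteVCdim D⇓y))
  ...   | no y≢1   = y≢1 (finite⇒1 (¬accepted⇒FiniteVCdim (λ D⇓1 → y≢1 (⇓-deterministic D⇓y D⇓1))))

corollary2p20 : ¬ (∃[ d ] DecidesOnClasses (decode d) FiniteVCdim)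
corollary2p20 (d , decides) = no-decider (decode d) decides
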